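{- Fix an integer $r \geq 3$. Let $\mathcal{P}^r = \{ (d_3(G), d_4(G)) : G \text{ is an } r\text{ -regular finite simple graph} \} \subset \mathbb{R}^2$. For any two points $P_1, P_2 \in \mathcal{P}^r$ and any rational number $0<q<1$, the convex combination $qP_1 + (1-q)P_2$ also lies in $\mathcal{P}^r$. Consequently, the closure of $\mathcal{P}^r$ is convex.
   Context: For a finite simple graph $G$ with vertex set $V(G)$, $c_k(G)$ denotes the total number of $k$-cycles (cycles of length $k$, counted as subgraphs) in $G$, and the density of $k$-cycles is $d_k(G) = c_k(G)/|V(G)|$. Graphs need not be connected. -}

module Defs where

open import Data.Bool using (Bool; true; false; if_then_else_; _∧_)
open import Data.Nat using (ℕ; zero; suc; _+_; _<ᵇ_; NonZero)
open import Data.Fin using (Fin; toℕ) renaming (zero to fz; suc to fs)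
open import Data.Integer using (+_)
open import Data.Rational using (ℚ; _/_)
open import Relation.Binary.PropositionalEquality using (_≡_)

Σ[Fin] : (n : ℕ) → (Fin n → ℕ) → ℕ
Σ[Fin] zero    f = 0
Σ[Fin] (suc n) f = f fz + Σ[Fin] n (λ i → f (fs i))

count : {n : ℕ} → (Fin n → Bool) → ℕ
count {n} p = Σ[Fin] n (λ i → if p i then 1 else 0)

_<F_ : {n : ℕ} → Fin n → Fin n → Bool
i <F j = toℕ i <ᵇ toℕ j

record Graph : Set where
  field
    n        : ℕ
    nonempty : NonZero n
    adj      : Fin n → Fin n → Bool
    sym      : ∀ i j → adj i j ≡ adj j i
    irrefl   : ∀ i → adj i i ≡ false

open Graph public

degree : (G : Graph) → Fin (n G) → ℕ
degree G v = count (adj G v)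

Regular : ℕ → Graph → Set
Regular r G = ∀ v → degree G v ≡ r

c₃ : Graph → ℕ
c₃ G = Σ[Fin] (n G) λ a → Σ[Fin] (n G) λ b → count λ c →
  (a <F b) ∧ (b <F c) ∧ adj G a b ∧ adj G b c ∧ adj G a c

-- A 4-cycle a-b-c-d-a is counted once
-- via its canonical labelling: a is its least vertex, c the vertex
-- opposite a, and b < d for the two neighbours of a on the cycle.
c₄ : Graph → ℕ
c₄ G = Σ[Fin] (n G) λ a → Σ[Fin] (n G) λ b → Σ[Fin] (n G) λ c → count λ d →
  (a <F b) ∧ (a <F c) ∧ (a <F d) ∧ (b <F d) ∧
  adj G a b ∧ adj G b c ∧ adj G c d ∧ adj G d a

d₃ : Graph → ℚ
d₃ G = _/_ (+ c₃ G) (n G) {{nonempty G}}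

d₄ : Graph → ℚ
d₄ G = _/_ (+ c₄ G) (n G) {{nonempty G}}

-- Write q = a / (a + d). The disjoint union of a·|G₂| copies of G₁ and d·|G₁| copies of G₂
-- is again r-regular and has (a + d)·|G₁|·|G₂| vertices. A cycle never leaves a connected
-- component, so c_k is additive over disjoint unions and the union has
-- a·|G₂|·c_k(G₁) + d·|G₁|·c_k(G₂) cycles of length k; dividing, its k-cycle density is exactly
-- q·d_k(G₁) + (1 - q)·d_k(G₂).

module Submission where

open import Data.Bool using (Bool; true; false; if_then_else_; _∧_)
open import Data.Bool.Properties using (¬-not; ∧-conicalˡ; ∧-conicalʳ)
open import Data.Fin using (Fin; _↑ˡ_; _↑ʳ_; splitAt; join) renaming (zero to fz; suc to fs)
open import Data.Fin.Properties using (toℕ-↑ˡ; splitAt-↑ˡ; splitAt-↑ʳ; join-splitAt)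
open import Data.Integer as ℤ using (+_; +0; +[1+_]; -[1+_]; +<+)
open import Data.Integer.Properties using (pos-+; pos-*; drop‿+<+)
open import Data.Integer.Tactic.RingSolver renaming (solve-∀ to ℤ-solve-∀)
open import Data.Nat as ℕ using (ℕ; zero; suc; _+_; _*_; _<ᵇ_; _≤_; NonZero)
import Data.Nat.Properties as ℕ
open import Data.Nat.Tactic.RingSolver renaming (solve-∀ to ℕ-solve-∀)
open import Data.Product using (Σ; _×_; _,_; proj₁; proj₂)
open import Data.Rational as ℚ using (ℚ; mkℚ; 0ℚ; 1ℚ; _/_; toℚᵘ; *<*)
open import Data.Rational.Properties
  using (↥p/↧p≡p; /-cong; toℚᵘ-fromℚᵘ; toℚᵘ-injective; toℚᵘ-homo-+; toℚᵘ-homo-*; toℚᵘ-homo‿-)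
open import Data.Rational.Unnormalised as ℚᵘ using (*≡*; 1ℚᵘ)
import Data.Rational.Unnormalised.Properties as ℚᵘ
open import Data.Sum using (_⊎_; inj₁; inj₂; [_,_]′)
open import Function using (_∘_; const)
open import Relation.Binary.PropositionalEquality

open import Defs hiding (sym)

Σ[Fin]-cong : ∀ n {f g : Fin n → ℕ} → (∀ i → f i ≡ g i) → Σ[Fin] n f ≡ Σ[Fin] n g
Σ[Fin]-cong zero    f≡g = refl
Σ[Fin]-cong (suc n) f≡g = cong₂ _+_ (f≡g fz) (Σ[Fin]-cong n (f≡g ∘ fs))

Σ[Fin]-zero : ∀ n {f : Fin n → ℕ} → (∀ i → f i ≡ 0) → Σ[Fin] n f ≡ 0
Σ[Fin]-zero zero    f≡0 = refl
Σ[Fin]-zero (suc n) f≡0 = cong₂ _+_ (f≡0 fz) (Σ[Fin]-zero n (f≡0 ∘ fs))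

Σ[Fin]-++ : ∀ m n (f : Fin (m + n) → ℕ) →
  Σ[Fin] (m + n) f ≡ Σ[Fin] m (f ∘ (_↑ˡ n)) + Σ[Fin] n (f ∘ (m ↑ʳ_))
Σ[Fin]-++ zero    n f = refl
Σ[Fin]-++ (suc m) n f =
  trans (cong (f fz ℕ.+_) (Σ[Fin]-++ m n (f ∘ fs))) (sym (ℕ.+-assoc (f fz) _ _))

Σ[Fin]-↑ˡ : ∀ m n {f : Fin (m + n) → ℕ} → (∀ j → f (m ↑ʳ j) ≡ 0) →
  Σ[Fin] (m + n) f ≡ Σ[Fin] m (f ∘ (_↑ˡ n))
Σ[Fin]-↑ˡ m n {f} f≡0 =
  trans (Σ[Fin]-++ m n f) (trans (cong₂ _+_ refl (Σ[Fin]-zero n f≡0)) (ℕ.+-identityʳ _))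

Σ[Fin]-↑ʳ : ∀ m n {f : Fin (m + n) → ℕ} → (∀ i → f (i ↑ˡ n) ≡ 0) →
  Σ[Fin] (m + n) f ≡ Σ[Fin] n (f ∘ (m ↑ʳ_))
Σ[Fin]-↑ʳ m n {f} f≡0 = trans (Σ[Fin]-++ m n f) (cong₂ _+_ (Σ[Fin]-zero m f≡0) refl)

indicator : Bool → ℕ
indicator b = if b then 1 else 0

count-cong : ∀ {n} {p q : Fin n → Bool} → (∀ i → p i ≡ q i) → count p ≡ count q
count-cong {n} p≡q = Σ[Fin]-cong n (cong indicator ∘ p≡q)

count-none : ∀ {n} {p : Fin n → Bool} → (∀ i → p i ≡ false) → count p ≡ 0
count-none {n} p≡false = Σ[Fin]-zero n (cong indicator ∘ p≡false)

count-↑ˡ : ∀ m n {p : Fin (m + n) → Bool} → (∀ j → p (m ↑ʳ j) ≡ false) →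
  count p ≡ count (p ∘ (_↑ˡ n))
count-↑ˡ m n p≡false = Σ[Fin]-↑ˡ m n (cong indicator ∘ p≡false)

count-↑ʳ : ∀ m n {p : Fin (m + n) → Bool} → (∀ i → p (i ↑ˡ n) ≡ false) →
  count p ≡ count (p ∘ (m ↑ʳ_))
count-↑ʳ m n p≡false = Σ[Fin]-↑ʳ m n (cong indicator ∘ p≡false)

count³ : ∀ {n} → (Fin n → Fin n → Fin n → Bool) → ℕ
count³ {n} P = Σ[Fin] n λ a → Σ[Fin] n λ b → count (P a b)

count⁴ : ∀ {n} → (Fin n → Fin n → Fin n → Fin n → Bool) → ℕ
count⁴ {n} P = Σ[Fin] n λ a → count³ (P a)

count³-cong : ∀ {n} {P Q : Fin n → Fin n → Fin n → Bool} →
  (∀ a b c → P a b c ≡ Q a b c) → count³ P ≡ count³ Q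
count³-cong {n} P≡Q = Σ[Fin]-cong n λ a → Σ[Fin]-cong n λ b → count-cong (P≡Q a b)

count⁴-cong : ∀ {n} {P Q : Fin n → Fin n → Fin n → Fin n → Bool} →
  (∀ a b c d → P a b c d ≡ Q a b c d) → count⁴ P ≡ count⁴ Q
count⁴-cong {n} P≡Q = Σ[Fin]-cong n λ a → count³-cong (P≡Q a)

count³-none : ∀ {n} {P : Fin n → Fin n → Fin n → Bool} →
  (∀ a b c → P a b c ≡ false) → count³ P ≡ 0
count³-none {n} P≡false = Σ[Fin]-zero n λ a → Σ[Fin]-zero n λ b → count-none (P≡false a b)

inLeft : ∀ m {n} → Fin (m + n) → Bool
inLeft m x = [ const true , const false ]′ (splitAt m x)

↑ˡ-↑ʳ-apart : ∀ m n (i : Fin m) (j : Fin n) → inLeft m (i ↑ˡ n) ≢ inLeft m (m ↑ʳ j)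
↑ˡ-↑ʳ-apart m n i j rewrite splitAt-↑ˡ m i n | splitAt-↑ʳ m n j = λ ()

↑ʳ-↑ˡ-apart : ∀ m n (i : Fin m) (j : Fin n) → inLeft m (m ↑ʳ j) ≢ inLeft m (i ↑ˡ n)
↑ʳ-↑ˡ-apart m n i j = ↑ˡ-↑ʳ-apart m n i j ∘ sym

Local₃ : ∀ m {n} → (Fin (m + n) → Fin (m + n) → Fin (m + n) → Bool) → Set
Local₃ m P = ∀ x y z → P x y z ≡ true → inLeft m x ≡ inLeft m y × inLeft m y ≡ inLeft m z

Local₄ : ∀ m {n} → (Fin (m + n) → Fin (m + n) → Fin (m + n) → Fin (m + n) → Bool) → Set
Local₄ m P = ∀ x y z w → P x y z w ≡ true →
  inLeft m x ≡ inLeft m y × inLeft m y ≡ inLeft m z × inLeft m z ≡ inLeft m w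

count³-local : ∀ m n {P : Fin (m + n) → Fin (m + n) → Fin (m + n) → Bool} → Local₃ m P →
  count³ P ≡ count³ (λ a b c → P (a ↑ˡ n) (b ↑ˡ n) (c ↑ˡ n))
           + count³ (λ a b c → P (m ↑ʳ a) (m ↑ʳ b) (m ↑ʳ c))
count³-local m n {P} local =
  trans (Σ[Fin]-++ m n _) (cong₂ _+_ (Σ[Fin]-cong m left) (Σ[Fin]-cong n right))
  where
  left : ∀ a → Σ[Fin] (m + n) (λ b → count (P (a ↑ˡ n) b))
               ≡ Σ[Fin] m (λ b → count (λ c → P (a ↑ˡ n) (b ↑ˡ n) (c ↑ˡ n)))
  left a = trans
    (Σ[Fin]-↑ˡ m n λ j → count-none λ c → ¬-not (↑ˡ-↑ʳ-apart m n a j ∘ proj₁ ∘ local _ _ c))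
    (Σ[Fin]-cong m λ b → count-↑ˡ m n λ k → ¬-not (↑ˡ-↑ʳ-apart m n b k ∘ proj₂ ∘ local _ _ _))
  right : ∀ a → Σ[Fin] (m + n) (λ b → count (P (m ↑ʳ a) b))
                ≡ Σ[Fin] n (λ b → count (λ c → P (m ↑ʳ a) (m ↑ʳ b) (m ↑ʳ c)))
  right a = trans
    (Σ[Fin]-↑ʳ m n λ i → count-none λ c → ¬-not (↑ʳ-↑ˡ-apart m n i a ∘ proj₁ ∘ local _ _ c))
    (Σ[Fin]-cong n λ b → count-↑ʳ m n λ k → ¬-not (↑ʳ-↑ˡ-apart m n k b ∘ proj₂ ∘ local _ _ _))

count⁴-local : ∀ m n {P : Fin (m + n) → Fin (m + n) → Fin (m + n) → Fin (m + n) → Bool} →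
  Local₄ m P →
  count⁴ P ≡ count⁴ (λ a b c d → P (a ↑ˡ n) (b ↑ˡ n) (c ↑ˡ n) (d ↑ˡ n))
           + count⁴ (λ a b c d → P (m ↑ʳ a) (m ↑ʳ b) (m ↑ʳ c) (m ↑ʳ d))
count⁴-local m n {P} local =
  trans (Σ[Fin]-++ m n _) (cong₂ _+_ (Σ[Fin]-cong m left) (Σ[Fin]-cong n right))
  where
  tail-local : ∀ x → Local₃ m (P x)
  tail-local x y z w = proj₂ ∘ local x y z w

  left : ∀ a → count³ (P (a ↑ˡ n)) ≡ count³ (λ b c d → P (a ↑ˡ n) (b ↑ˡ n) (c ↑ˡ n) (d ↑ˡ n))
  left a = trans (count³-local m n (tail-local (a ↑ˡ n)))
    (trans (cong₂ _+_ refl (count³-none λ j _ _ →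
                              ¬-not (↑ˡ-↑ʳ-apart m n a j ∘ proj₁ ∘ local _ _ _ _)))
           (ℕ.+-identityʳ _))

  right : ∀ a → count³ (P (m ↑ʳ a)) ≡ count³ (λ b c d → P (m ↑ʳ a) (m ↑ʳ b) (m ↑ʳ c) (m ↑ʳ d))
  right a = trans (count³-local m n (tail-local (m ↑ʳ a)))
    (cong₂ _+_ (count³-none λ i _ _ → ¬-not (↑ʳ-↑ˡ-apart m n i a ∘ proj₁ ∘ local _ _ _ _)) refl)

module _ (G H : Graph) where

  adj-⊎ : Fin (n G) ⊎ Fin (n H) → Fin (n G) ⊎ Fin (n H) → Bool
  adj-⊎ (inj₁ i) (inj₁ j) = adj G i j
  adj-⊎ (inj₂ i) (inj₂ j) = adj H i j
  adj-⊎ _        _        = false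

  adj-⊎-sym : ∀ s t → adj-⊎ s t ≡ adj-⊎ t s
  adj-⊎-sym (inj₁ i) (inj₁ j) = Graph.sym G i j
  adj-⊎-sym (inj₂ i) (inj₂ j) = Graph.sym H i j
  adj-⊎-sym (inj₁ i) (inj₂ j) = refl
  adj-⊎-sym (inj₂ i) (inj₁ j) = refl

  adj-⊎-irrefl : ∀ s → adj-⊎ s s ≡ false
  adj-⊎-irrefl (inj₁ i) = irrefl G i
  adj-⊎-irrefl (inj₂ i) = irrefl H i

  adj-⊎-local : ∀ s t → adj-⊎ s t ≡ true →
    [ const true , const false ]′ s ≡ [ const true , const false ]′ t
  adj-⊎-local (inj₁ i) (inj₁ j) _ = refl
  adj-⊎-local (inj₂ i) (inj₂ j) _ = refl

infixr 6 _⊕_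

_⊕_ : Graph → Graph → Graph
G ⊕ H = record
  { n        = n G + n H
  ; nonempty = ℕ.>-nonZero
                 (ℕ.≤-trans (ℕ.>-nonZero⁻¹ (n G) {{nonempty G}}) (ℕ.m≤m+n (n G) (n H)))
  ; adj      = λ x y → adj-⊎ G H (splitAt (n G) x) (splitAt (n G) y)
  ; sym      = λ x y → adj-⊎-sym G H (splitAt (n G) x) (splitAt (n G) y)
  ; irrefl   = λ x → adj-⊎-irrefl G H (splitAt (n G) x)
  }

module _ (G H : Graph) where

  adj-⊕-↑ˡ : ∀ i j → adj (G ⊕ H) (i ↑ˡ n H) (j ↑ˡ n H) ≡ adj G i j
  adj-⊕-↑ˡ i j = cong₂ (adj-⊎ G H) (splitAt-↑ˡ (n G) i (n H)) (splitAt-↑ˡ (n G) j (n H))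

  adj-⊕-↑ʳ : ∀ i j → adj (G ⊕ H) (n G ↑ʳ i) (n G ↑ʳ j) ≡ adj H i j
  adj-⊕-↑ʳ i j = cong₂ (adj-⊎ G H) (splitAt-↑ʳ (n G) (n H) i) (splitAt-↑ʳ (n G) (n H) j)

  adj-⊕-↑ˡ↑ʳ : ∀ i j → adj (G ⊕ H) (i ↑ˡ n H) (n G ↑ʳ j) ≡ false
  adj-⊕-↑ˡ↑ʳ i j = cong₂ (adj-⊎ G H) (splitAt-↑ˡ (n G) i (n H)) (splitAt-↑ʳ (n G) (n H) j)

  adj-⊕-↑ʳ↑ˡ : ∀ i j → adj (G ⊕ H) (n G ↑ʳ i) (j ↑ˡ n H) ≡ false
  adj-⊕-↑ʳ↑ˡ i j = cong₂ (adj-⊎ G H) (splitAt-↑ʳ (n G) (n H) i) (splitAt-↑ˡ (n G) j (n H))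

  adj-⊕-local : ∀ x y → adj (G ⊕ H) x y ≡ true → inLeft (n G) x ≡ inLeft (n G) y
  adj-⊕-local x y = adj-⊎-local G H (splitAt (n G) x) (splitAt (n G) y)

  degree-⊕-↑ˡ : ∀ i → degree (G ⊕ H) (i ↑ˡ n H) ≡ degree G i
  degree-⊕-↑ˡ i = trans (count-↑ˡ (n G) (n H) (adj-⊕-↑ˡ↑ʳ i)) (count-cong (adj-⊕-↑ˡ i))

  degree-⊕-↑ʳ : ∀ j → degree (G ⊕ H) (n G ↑ʳ j) ≡ degree H j
  degree-⊕-↑ʳ j = trans (count-↑ʳ (n G) (n H) (adj-⊕-↑ʳ↑ˡ j)) (count-cong (adj-⊕-↑ʳ j))

regular-⊕ : ∀ {r G H} → Regular r G → Regular r H → Regular r (G ⊕ H)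
regular-⊕ {r} {G} {H} regG regH x =
  subst (λ v → degree (G ⊕ H) v ≡ r) (join-splitAt (n G) (n H) x) (on-blocks (splitAt (n G) x))
  where
  on-blocks : ∀ s → degree (G ⊕ H) (join (n G) (n H) s) ≡ r
  on-blocks (inj₁ i) = trans (degree-⊕-↑ˡ G H i) (regG i)
  on-blocks (inj₂ j) = trans (degree-⊕-↑ʳ G H j) (regH j)

<F-↑ˡ : ∀ {m} n (i j : Fin m) → (i ↑ˡ n) <F (j ↑ˡ n) ≡ i <F j
<F-↑ˡ n i j = cong₂ _<ᵇ_ (toℕ-↑ˡ i n) (toℕ-↑ˡ j n)

<F-↑ʳ : ∀ m {n} (i j : Fin n) → (m ↑ʳ i) <F (m ↑ʳ j) ≡ i <F j
<F-↑ʳ zero    i j = refl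
<F-↑ʳ (suc m) i j = <F-↑ʳ m i j

triangle? : (G : Graph) → Fin (n G) → Fin (n G) → Fin (n G) → Bool
triangle? G a b c = (a <F b) ∧ (b <F c) ∧ adj G a b ∧ adj G b c ∧ adj G a c

square? : (G : Graph) → Fin (n G) → Fin (n G) → Fin (n G) → Fin (n G) → Bool
square? G a b c d =
  (a <F b) ∧ (a <F c) ∧ (a <F d) ∧ (b <F d) ∧ adj G a b ∧ adj G b c ∧ adj G c d ∧ adj G d a

triangle?⇒adj : ∀ G a b c → triangle? G a b c ≡ true → adj G a b ≡ true × adj G b c ≡ true
triangle?⇒adj G a b c t = ∧-conicalˡ _ _ edges , ∧-conicalˡ _ _ (∧-conicalʳ (adj G a b) _ edges)
  where edges = ∧-conicalʳ (b <F c) _ (∧-conicalʳ (a <F b) _ t)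

square?⇒adj : ∀ G a b c d → square? G a b c d ≡ true →
  adj G a b ≡ true × adj G b c ≡ true × adj G c d ≡ true
square?⇒adj G a b c d t =
  ∧-conicalˡ _ _ edges , ∧-conicalˡ _ _ edges′ , ∧-conicalˡ _ _ (∧-conicalʳ (adj G b c) _ edges′)
  where
  edges  = ∧-conicalʳ (b <F d) _ (∧-conicalʳ (a <F d) _
             (∧-conicalʳ (a <F c) _ (∧-conicalʳ (a <F b) _ t)))
  edges′ = ∧-conicalʳ (adj G a b) _ edges

Additive : (Graph → ℕ) → Set
Additive f = ∀ G H → f (G ⊕ H) ≡ f G + f H

c₃-⊕ : Additive c₃
c₃-⊕ G H = trans (count³-local (n G) (n H) local)
  (cong₂ _+_ (count³-cong triangle?-↑ˡ) (count³-cong triangle?-↑ʳ))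
  where
  local : Local₃ (n G) (triangle? (G ⊕ H))
  local x y z t = let xy , yz = triangle?⇒adj (G ⊕ H) x y z t in
    adj-⊕-local G H x y xy , adj-⊕-local G H y z yz
  triangle?-↑ˡ : ∀ a b c → triangle? (G ⊕ H) (a ↑ˡ n H) (b ↑ˡ n H) (c ↑ˡ n H) ≡ triangle? G a b c
  triangle?-↑ˡ a b c
    rewrite <F-↑ˡ (n H) a b | <F-↑ˡ (n H) b c
          | adj-⊕-↑ˡ G H a b | adj-⊕-↑ˡ G H b c | adj-⊕-↑ˡ G H a c = refl
  triangle?-↑ʳ : ∀ a b c → triangle? (G ⊕ H) (n G ↑ʳ a) (n G ↑ʳ b) (n G ↑ʳ c) ≡ triangle? H a b c
  triangle?-↑ʳ a b c
    rewrite <F-↑ʳ (n G) a b | <F-↑ʳ (n G) b c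
          | adj-⊕-↑ʳ G H a b | adj-⊕-↑ʳ G H b c | adj-⊕-↑ʳ G H a c = refl

c₄-⊕ : Additive c₄
c₄-⊕ G H = trans (count⁴-local (n G) (n H) local)
  (cong₂ _+_ (count⁴-cong square?-↑ˡ) (count⁴-cong square?-↑ʳ))
  where
  local : Local₄ (n G) (square? (G ⊕ H))
  local x y z w s = let xy , yz , zw = square?⇒adj (G ⊕ H) x y z w s in
    adj-⊕-local G H x y xy , adj-⊕-local G H y z yz , adj-⊕-local G H z w zw
  square?-↑ˡ : ∀ a b c d →
    square? (G ⊕ H) (a ↑ˡ n H) (b ↑ˡ n H) (c ↑ˡ n H) (d ↑ˡ n H) ≡ square? G a b c d
  square?-↑ˡ a b c d
    rewrite <F-↑ˡ (n H) a b | <F-↑ˡ (n H) a c | <F-↑ˡ (n H) a d | <F-↑ˡ (n H) b d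
          | adj-⊕-↑ˡ G H a b | adj-⊕-↑ˡ G H b c | adj-⊕-↑ˡ G H c d | adj-⊕-↑ˡ G H d a = refl
  square?-↑ʳ : ∀ a b c d →
    square? (G ⊕ H) (n G ↑ʳ a) (n G ↑ʳ b) (n G ↑ʳ c) (n G ↑ʳ d) ≡ square? H a b c d
  square?-↑ʳ a b c d
    rewrite <F-↑ʳ (n G) a b | <F-↑ʳ (n G) a c | <F-↑ʳ (n G) a d | <F-↑ʳ (n G) b d
          | adj-⊕-↑ʳ G H a b | adj-⊕-↑ʳ G H b c | adj-⊕-↑ʳ G H c d | adj-⊕-↑ʳ G H d a = refl

n-⊕ : Additive n
n-⊕ G H = refl

infixr 7 _·_

_·_ : (k : ℕ) → .{{NonZero k}} → Graph → Graph
1           · G = G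
suc (suc k) · G = G ⊕ suc k · G

·-additive : ∀ f → Additive f → ∀ k .{{_ : NonZero k}} G → f (k · G) ≡ k * f G
·-additive f f-⊕ 1             G = sym (ℕ.+-identityʳ (f G))
·-additive f f-⊕ (suc (suc k)) G =
  trans (f-⊕ G (suc k · G)) (cong (f G ℕ.+_) (·-additive f f-⊕ (suc k) G))

regular-· : ∀ {r G} k .{{_ : NonZero k}} → Regular r G → Regular r (k · G)
regular-· 1             regG = regG
regular-· (suc (suc k)) regG = regular-⊕ regG (regular-· (suc k) regG)

module _ (a d : ℕ) .{{_ : NonZero a}} .{{_ : NonZero d}} (G₁ G₂ : Graph) where

  private instance
    n₁≢0 = nonempty G₁
    n₂≢0 = nonempty G₂
    a·n₂≢0 = ℕ.m*n≢0 a (n G₂)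
    d·n₁≢0 = ℕ.m*n≢0 d (n G₁)

  mixture : Graph
  mixture = (a * n G₂) · G₁ ⊕ (d * n G₁) · G₂

  regular-mixture : ∀ {r} → Regular r G₁ → Regular r G₂ → Regular r mixture
  regular-mixture reg₁ reg₂ = regular-⊕ (regular-· (a * n G₂) reg₁) (regular-· (d * n G₁) reg₂)

  mixture-additive : ∀ f → Additive f → f mixture ≡ a * n G₂ * f G₁ + d * n G₁ * f G₂
  mixture-additive f f-⊕ =
    trans (f-⊕ _ _) (cong₂ _+_ (·-additive f f-⊕ (a * n G₂) G₁) (·-additive f f-⊕ (d * n G₁) G₂))

toℚᵘ-/ : ∀ i n .{{_ : NonZero n}} → toℚᵘ (i / n) ℚᵘ.≃ i ℚᵘ./ n
toℚᵘ-/ i (suc n) = toℚᵘ-fromℚᵘ (i ℚᵘ./ suc n)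

toℚᵘ-mean : ∀ p x y → toℚᵘ (p ℚ.* x ℚ.+ (1ℚ ℚ.- p) ℚ.* y)
  ℚᵘ.≃ toℚᵘ p ℚᵘ.* toℚᵘ x ℚᵘ.+ (1ℚᵘ ℚᵘ.- toℚᵘ p) ℚᵘ.* toℚᵘ y
toℚᵘ-mean p x y = begin
  toℚᵘ (p ℚ.* x ℚ.+ (1ℚ ℚ.- p) ℚ.* y)
    ≈⟨ toℚᵘ-homo-+ (p ℚ.* x) ((1ℚ ℚ.- p) ℚ.* y) ⟩
  toℚᵘ (p ℚ.* x) ℚᵘ.+ toℚᵘ ((1ℚ ℚ.- p) ℚ.* y)
    ≈⟨ ℚᵘ.+-cong (toℚᵘ-homo-* p x) (toℚᵘ-homo-* (1ℚ ℚ.- p) y) ⟩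
  toℚᵘ p ℚᵘ.* toℚᵘ x ℚᵘ.+ toℚᵘ (1ℚ ℚ.- p) ℚᵘ.* toℚᵘ y
    ≈⟨ ℚᵘ.+-congʳ (toℚᵘ p ℚᵘ.* toℚᵘ x) (ℚᵘ.*-congʳ {toℚᵘ y} toℚᵘ-1-p) ⟩
  toℚᵘ p ℚᵘ.* toℚᵘ x ℚᵘ.+ (1ℚᵘ ℚᵘ.- toℚᵘ p) ℚᵘ.* toℚᵘ y ∎
  where
  open ℚᵘ.≃-Reasoning
  toℚᵘ-1-p : toℚᵘ (1ℚ ℚ.- p) ℚᵘ.≃ 1ℚᵘ ℚᵘ.- toℚᵘ p
  toℚᵘ-1-p = ℚᵘ.≃-trans (toℚᵘ-homo-+ 1ℚ (ℚ.- p)) (ℚᵘ.+-congʳ 1ℚᵘ (toℚᵘ-homo‿- p))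

pos-+-* : ∀ a b c d e f → + (a * b * c + d * e * f) ≡ + a ℤ.* + b ℤ.* + c ℤ.+ + d ℤ.* + e ℤ.* + f
pos-+-* a b c d e f = trans (pos-+ (a * b * c) _) (cong₂ ℤ._+_ (pos-*-* a b c) (pos-*-* d e f))
  where
  pos-*-* : ∀ x y z → + (x * y * z) ≡ + x ℤ.* + y ℤ.* + z
  pos-*-* x y z = trans (pos-* (x * y) z) (cong (ℤ._* + z) (pos-* x y))

mean-/ᵘ : ∀ a d c₁ c₂ n₁ n₂ →
  + (suc a * suc n₂ * c₁ + d * suc n₁ * c₂) ℚᵘ./ ((suc a + d) * suc n₁ * suc n₂)
  ℚᵘ.≃ (+ suc a ℚᵘ./ (suc a + d)) ℚᵘ.* (+ c₁ ℚᵘ./ suc n₁)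
       ℚᵘ.+ (1ℚᵘ ℚᵘ.- + suc a ℚᵘ./ (suc a + d)) ℚᵘ.* (+ c₂ ℚᵘ./ suc n₂)
mean-/ᵘ a d c₁ c₂ n₁ n₂ = *≡* (trans
  (cong₂ ℤ._*_ (pos-+-* (suc a) (suc n₂) c₁ d (suc n₁) c₂) refl)
  (cross-multiplied (+ suc a) (+ d) (+ c₁) (+ c₂) (+ suc n₁) (+ suc n₂)))
  where
  -- The shape of ↥ and ↧ of both sides once ℚᵘ arithmetic unfolds (1ℚᵘ contributes the + 1s).
  cross-multiplied : ∀ a d c₁ c₂ n₁ n₂ →
    (a ℤ.* n₂ ℤ.* c₁ ℤ.+ d ℤ.* n₁ ℤ.* c₂) ℤ.* ((a ℤ.+ d) ℤ.* n₁ ℤ.* (+ 1 ℤ.* (a ℤ.+ d) ℤ.* n₂))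
    ≡ (a ℤ.* c₁ ℤ.* (+ 1 ℤ.* (a ℤ.+ d) ℤ.* n₂)
       ℤ.+ (+ 1 ℤ.* (a ℤ.+ d) ℤ.+ ℤ.- a ℤ.* + 1) ℤ.* c₂ ℤ.* ((a ℤ.+ d) ℤ.* n₁))
      ℤ.* ((a ℤ.+ d) ℤ.* n₁ ℤ.* n₂)
  cross-multiplied = ℤ-solve-∀

/-mean : ∀ a d c₁ c₂ n₁ n₂ {C N} .{{_ : NonZero n₁}} .{{_ : NonZero n₂}} .{{_ : NonZero N}} →
  C ≡ suc a * n₂ * c₁ + d * n₁ * c₂ → N ≡ (suc a + d) * n₁ * n₂ →
  + C / N ≡ + suc a / (suc a + d) ℚ.* (+ c₁ / n₁) ℚ.+ (1ℚ ℚ.- + suc a / (suc a + d)) ℚ.* (+ c₂ / n₂)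
/-mean a d c₁ c₂ (suc n₁) (suc n₂) refl refl = toℚᵘ-injective (begin
  toℚᵘ (+ C / N)
    ≈⟨ toℚᵘ-/ (+ C) N ⟩
  + C ℚᵘ./ N
    ≈⟨ mean-/ᵘ a d c₁ c₂ n₁ n₂ ⟩
  q ℚᵘ.* x ℚᵘ.+ (1ℚᵘ ℚᵘ.- q) ℚᵘ.* y
    ≈⟨ ℚᵘ.+-cong (ℚᵘ.*-cong p≃q x≃) (ℚᵘ.*-cong (ℚᵘ.+-congʳ 1ℚᵘ (ℚᵘ.-‿cong p≃q)) y≃) ⟨
  toℚᵘ p ℚᵘ.* toℚᵘ (+ c₁ / suc n₁) ℚᵘ.+ (1ℚᵘ ℚᵘ.- toℚᵘ p) ℚᵘ.* toℚᵘ (+ c₂ / suc n₂)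
    ≈⟨ toℚᵘ-mean p (+ c₁ / suc n₁) (+ c₂ / suc n₂) ⟨
  toℚᵘ (p ℚ.* (+ c₁ / suc n₁) ℚ.+ (1ℚ ℚ.- p) ℚ.* (+ c₂ / suc n₂)) ∎)
  where
  open ℚᵘ.≃-Reasoning
  C = suc a * suc n₂ * c₁ + d * suc n₁ * c₂
  N = (suc a + d) * suc n₁ * suc n₂
  p = + suc a / (suc a + d)
  q = + suc a ℚᵘ./ (suc a + d)
  x = + c₁ ℚᵘ./ suc n₁
  y = + c₂ ℚᵘ./ suc n₂
  p≃q : toℚᵘ p ℚᵘ.≃ q
  p≃q = toℚᵘ-/ (+ suc a) (suc a + d)
  x≃ : toℚᵘ (+ c₁ / suc n₁) ℚᵘ.≃ x
  x≃ = toℚᵘ-/ (+ c₁) (suc n₁)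
  y≃ : toℚᵘ (+ c₂ / suc n₂) ℚᵘ.≃ y
  y≃ = toℚᵘ-/ (+ c₂) (suc n₂)

density : (Graph → ℕ) → Graph → ℚ
density f G = _/_ (+ f G) (n G) {{nonempty G}}

density-mixture : ∀ f → Additive f → ∀ a d .{{_ : NonZero d}} G₁ G₂ →
  density f (mixture (suc a) d G₁ G₂)
  ≡ + suc a / (suc a + d) ℚ.* density f G₁ ℚ.+ (1ℚ ℚ.- + suc a / (suc a + d)) ℚ.* density f G₂
density-mixture f f-⊕ a d G₁ G₂ =
  /-mean a d (f G₁) (f G₂) (n G₁) (n G₂) {{nonempty G₁}} {{nonempty G₂}} {{nonempty M}}
    (mixture-additive (suc a) d G₁ G₂ f f-⊕)
    (trans (mixture-additive (suc a) d G₁ G₂ n n-⊕) (regroup (suc a) d (n G₁) (n G₂)))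
  where
  M = mixture (suc a) d G₁ G₂
  regroup : ∀ a d n₁ n₂ → a * n₂ * n₁ + d * n₁ * n₂ ≡ (a + d) * n₁ * n₂
  regroup = ℕ-solve-∀

0<q<1⇒q≡a/[a+d] : ∀ q → 0ℚ ℚ.< q → q ℚ.< 1ℚ →
  Σ ℕ λ a → Σ ℕ λ d → q ≡ + suc a / (suc a + suc d)
0<q<1⇒q≡a/[a+d] (mkℚ +0 _ _) (*<* (+<+ ())) _
0<q<1⇒q≡a/[a+d] (mkℚ -[1+ _ ] _ _) (*<* ()) _
0<q<1⇒q≡a/[a+d] q@(mkℚ +[1+ a ] b-1 _) _ (*<* q<1) =
  a , d , trans (sym (↥p/↧p≡p q)) (/-cong {+ suc a} refl (sym a+d≡b))
  where
  a<b : suc a ℕ.< suc b-1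
  a<b = subst₂ ℕ._<_ (ℕ.*-identityʳ (suc a)) (ℕ.*-identityˡ (suc b-1)) (drop‿+<+ q<1)
  d = proj₁ (ℕ.m≤n⇒∃[o]m+o≡n a<b)
  a+d≡b : suc a + suc d ≡ suc b-1
  a+d≡b = trans (ℕ.+-suc (suc a) d) (proj₂ (ℕ.m≤n⇒∃[o]m+o≡n a<b))

-- Stated for d₃ and d₄ themselves: unifying density c₃ with d₃ under a concrete weight
-- makes Agda unfold the gcd normalisation of the weight, which is prohibitively slow.
d₃-mixture : ∀ a d .{{_ : NonZero d}} G₁ G₂ →
  d₃ (mixture (suc a) d G₁ G₂)
  ≡ + suc a / (suc a + d) ℚ.* d₃ G₁ ℚ.+ (1ℚ ℚ.- + suc a / (suc a + d)) ℚ.* d₃ G₂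
d₃-mixture = density-mixture c₃ c₃-⊕

d₄-mixture : ∀ a d .{{_ : NonZero d}} G₁ G₂ →
  d₄ (mixture (suc a) d G₁ G₂)
  ≡ + suc a / (suc a + d) ℚ.* d₄ G₁ ℚ.+ (1ℚ ℚ.- + suc a / (suc a + d)) ℚ.* d₄ G₂
d₄-mixture = density-mixture c₄ c₄-⊕

proposition2p1 : (r : ℕ) → 3 ≤ r → (G₁ G₂ : Graph) → Regular r G₁ → Regular r G₂
    → (q : ℚ) → 0ℚ ℚ.< q → q ℚ.< 1ℚ
    → Σ Graph (λ G → Regular r G
    × (d₃ G ≡ q ℚ.* d₃ G₁ ℚ.+ (1ℚ ℚ.- q) ℚ.* d₃ G₂)
    × (d₄ G ≡ q ℚ.* d₄ G₁ ℚ.+ (1ℚ ℚ.- q) ℚ.* d₄ G₂))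
-- The construction works for every r.
proposition2p1 r _ G₁ G₂ reg₁ reg₂ q 0<q q<1 with 0<q<1⇒q≡a/[a+d] q 0<q q<1
... | a , d , refl =
  mixture (suc a) (suc d) G₁ G₂ ,
  regular-mixture (suc a) (suc d) G₁ G₂ reg₁ reg₂ ,
  d₃-mixture a (suc d) G₁ G₂ ,
  d₄-mixture a (suc d) G₁ G₂
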